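{- For all $n\ge0$, \[ c_n^2=\delta_{n,0}+c_{n-1}^2+c_{n-3}^2+2\sum_{l=3}^np_{l-1}c_{n-l}^2 . \]
   Context: The Narayana's cows numbers $c_n$ are defined by $c_n=\delta_{n,0}+c_{n-1}+c_{n-3}$ for $n\ge0$, $c_n=0$ for $n<0$. The Padovan numbers $p_n$ are defined by $p_n=\delta_{n,0}+p_{n-2}+p_{n-3}$ for $n\ge0$, $p_n=0$ for $n<0$. $\delta_{i,j}$ is $1$ if $i=j$ and $0$ otherwise. -}

module Defs where

open import Data.Nat using (ℕ; zero; suc; _+_; _*_; _∸_; _≤?_)
open import Relation.Nullary using (yes; no)

-- Narayana's cows numbers: c 0 = 1, c n = c (n-1) + c (n-3), with c m = 0 for m < 0.
c : ℕ → ℕ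
c zero = 1
c (suc zero) = 1
c (suc (suc zero)) = 1
c (suc (suc (suc n))) = c (suc (suc n)) + c n

-- Padovan numbers: p 0 = 1, p n = p (n-2) + p (n-3), with p m = 0 for m < 0.
p : ℕ → ℕ
p zero = 1
p (suc zero) = 0
p (suc (suc zero)) = 1
p (suc (suc (suc n))) = p (suc n) + p n

-- c evaluated at the integer n - k (zero when n - k < 0)
cSub : ℕ → ℕ → ℕ
cSub n k with k ≤? n
... | yes _ = c (n ∸ k)
... | no _ = 0

δ0 : ℕ → ℕ
δ0 zero = 1
δ0 (suc _) = 0

-- Σ_{l=a}^{b} f l  (empty, i.e. 0, if b < a)
sumFromTo : ℕ → ℕ → (ℕ → ℕ) → ℕ
sumFromTo a zero f with a
... | zero = f 0
... | suc _ = 0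
sumFromTo a (suc b) f with a ≤? suc b
... | yes _ = sumFromTo a b f + f (suc b)
... | no _ = 0

{-# OPTIONS --safe #-}
module Submission where

-- For n = m + 3 the cows recurrence gives c(m+3)² = c(m+2)² + c(m)² + 2 c(m+2) c(m), so the
-- theorem amounts to the cross-term identity c(m+2) c(m) = Σ_{j≤m} p(j+2) c(m-j)².  Both
-- sides obey W(m+3) = c(m+3)² + c(m+2)² + W(m+1) + W(m): on the left by expanding with the
-- cows recurrence, on the right because the weights p(j+2) satisfy the Padovan recurrence
-- and start with 1, 1, 1.  The identity then follows by induction from three initial values.

open import Defs
open import Data.Nat using (ℕ; zero; suc; _+_; _*_; _∸_)
open import Data.Nat.Properties using (+-assoc)
open import Data.Nat.Tactic.RingSolver using (solve-∀)
open import Relation.Binary.PropositionalEquality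
  using (_≡_; refl; cong; cong₂; sym; trans; module ≡-Reasoning)

sumUpTo : ℕ → (ℕ → ℕ) → ℕ
sumUpTo zero    f = f 0
sumUpTo (suc k) f = sumUpTo k f + f (suc k)

sumUpTo-cong : ∀ k {f g : ℕ → ℕ} → (∀ j → f j ≡ g j) → sumUpTo k f ≡ sumUpTo k g
sumUpTo-cong zero    f≗g = f≗g 0
sumUpTo-cong (suc k) f≗g = cong₂ _+_ (sumUpTo-cong k f≗g) (f≗g (suc k))

sumUpTo-suc : ∀ k (f : ℕ → ℕ) → sumUpTo (suc k) f ≡ f 0 + sumUpTo k (λ j → f (suc j))
sumUpTo-suc zero    f = refl
sumUpTo-suc (suc k) f =
  trans (cong (_+ f (suc (suc k))) (sumUpTo-suc k f)) (+-assoc (f 0) _ _)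

sumUpTo-+ : ∀ k (f g : ℕ → ℕ) → sumUpTo k (λ j → f j + g j) ≡ sumUpTo k f + sumUpTo k g
sumUpTo-+ zero    f g = refl
sumUpTo-+ (suc k) f g =
  trans (cong (_+ (f (suc k) + g (suc k))) (sumUpTo-+ k f g))
        (interchange (sumUpTo k f) (sumUpTo k g) (f (suc k)) (g (suc k)))
  where
  interchange : ∀ a b x y → a + b + (x + y) ≡ a + x + (b + y)
  interchange = solve-∀

sumFromTo-3 : ∀ k (f : ℕ → ℕ) → sumFromTo 3 (3 + k) f ≡ sumUpTo k (λ j → f (3 + j))
sumFromTo-3 zero    f = refl
sumFromTo-3 (suc k) f = cong (_+ f (4 + k)) (sumFromTo-3 k f)

weightedCSquares : (ℕ → ℕ) → ℕ → ℕ
weightedCSquares a m = sumUpTo m (λ j → a j * c (m ∸ j) * c (m ∸ j))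

weightedCSquares-suc : ∀ a m →
  weightedCSquares a (suc m) ≡ a 0 * c (suc m) * c (suc m) + weightedCSquares (λ j → a (suc j)) m
weightedCSquares-suc a m = sumUpTo-suc m _

weightedCSquares-+ : ∀ a b m →
  weightedCSquares (λ j → a j + b j) m ≡ weightedCSquares a m + weightedCSquares b m
weightedCSquares-+ a b m =
  trans (sumUpTo-cong m (λ j → *-distribʳ-square (a j) (b j) (c (m ∸ j)))) (sumUpTo-+ m _ _)
  where
  *-distribʳ-square : ∀ x y z → (x + y) * z * z ≡ x * z * z + y * z * z
  *-distribʳ-square = solve-∀

padovanFrom2 : ℕ → ℕ
padovanFrom2 j = p (2 + j)

weightedCSquares-rec : ∀ m →
  weightedCSquares padovanFrom2 (3 + m) ≡
  c (3 + m) * c (3 + m) + c (2 + m) * c (2 + m)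
    + weightedCSquares padovanFrom2 (1 + m) + weightedCSquares padovanFrom2 m
weightedCSquares-rec m = begin
  W q (3 + m)
    ≡⟨ weightedCSquares-suc q (2 + m) ⟩
  q 0 * c3 * c3 + W (λ j → q (1 + j)) (2 + m)
    ≡⟨ cong (q 0 * c3 * c3 +_) (weightedCSquares-suc (λ j → q (1 + j)) (1 + m)) ⟩
  q 0 * c3 * c3 + (q 1 * c2 * c2 + W (λ j → q (2 + j)) (1 + m))
    ≡⟨ cong (λ t → q 0 * c3 * c3 + (q 1 * c2 * c2 + t)) (weightedCSquares-suc (λ j → q (2 + j)) m) ⟩
  q 0 * c3 * c3 + (q 1 * c2 * c2 + (q 2 * c1 * c1 + W (λ j → q (3 + j)) m))
    -- q (3 + j) reduces to q (1 + j) + q j, the Padovan recurrence, and q 0 = q 1 = q 2 = 1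
    ≡⟨ cong (λ t → q 0 * c3 * c3 + (q 1 * c2 * c2 + (q 2 * c1 * c1 + t)))
            (weightedCSquares-+ (λ j → q (1 + j)) q m) ⟩
  q 0 * c3 * c3 + (q 1 * c2 * c2 + (q 2 * c1 * c1 + (W (λ j → q (1 + j)) m + W q m)))
    ≡⟨ reassociate c3 c2 c1 (W (λ j → q (1 + j)) m) (W q m) ⟩
  c3 * c3 + c2 * c2 + (q 0 * c1 * c1 + W (λ j → q (1 + j)) m) + W q m
    ≡⟨ cong (λ t → c3 * c3 + c2 * c2 + t + W q m) (sym (weightedCSquares-suc q m)) ⟩
  c3 * c3 + c2 * c2 + W q (1 + m) + W q m ∎
  where
  open ≡-Reasoning
  W = weightedCSquares
  q = padovanFrom2
  c3 = c (3 + m)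
  c2 = c (2 + m)
  c1 = c (1 + m)
  reassociate : ∀ A B C D E →
    1 * A * A + (1 * B * B + (1 * C * C + (D + E))) ≡ A * A + B * B + (1 * C * C + D) + E
  reassociate = solve-∀

c-product-rec : ∀ m →
  c (5 + m) * c (3 + m) ≡
  c (3 + m) * c (3 + m) + c (2 + m) * c (2 + m) + c (3 + m) * c (1 + m) + c (2 + m) * c m
c-product-rec m = expand (c (2 + m)) (c (1 + m)) (c m)
  where
  expand : ∀ B C D → ((B + D + C) + B) * (B + D) ≡ (B + D) * (B + D) + B * B + (B + D) * C + B * D
  expand = solve-∀

c-square-rec : ∀ m → c (3 + m) * c (3 + m) ≡ c (2 + m) * c (2 + m) + c m * c m + 2 * (c (2 + m) * c m)
c-square-rec m = expand (c (2 + m)) (c m)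
  where
  expand : ∀ B D → (B + D) * (B + D) ≡ B * B + D * D + 2 * (B * D)
  expand = solve-∀

c-product≡weightedCSquares : ∀ m → c (2 + m) * c m ≡ weightedCSquares padovanFrom2 m
c-product≡weightedCSquares zero                = refl
c-product≡weightedCSquares (suc zero)          = refl
c-product≡weightedCSquares (suc (suc zero))    = refl
c-product≡weightedCSquares (suc (suc (suc m))) = begin
  c (5 + m) * c (3 + m)
    ≡⟨ c-product-rec m ⟩
  c (3 + m) * c (3 + m) + c (2 + m) * c (2 + m) + c (3 + m) * c (1 + m) + c (2 + m) * c m
    ≡⟨ cong₂ (λ x y → c (3 + m) * c (3 + m) + c (2 + m) * c (2 + m) + x + y)
             (c-product≡weightedCSquares (suc m)) (c-product≡weightedCSquares m) ⟩
  c (3 + m) * c (3 + m) + c (2 + m) * c (2 + m)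
    + weightedCSquares padovanFrom2 (1 + m) + weightedCSquares padovanFrom2 m
    ≡⟨ sym (weightedCSquares-rec m) ⟩
  weightedCSquares padovanFrom2 (3 + m) ∎
  where open ≡-Reasoning

mainTheorem13 : (n : ℕ) →
    c n * c n ≡ δ0 n + cSub n 1 * cSub n 1 + cSub n 3 * cSub n 3
    + 2 * sumFromTo 3 n (λ l → p (l ∸ 1) * c (n ∸ l) * c (n ∸ l))
mainTheorem13 zero             = refl
mainTheorem13 (suc zero)       = refl
mainTheorem13 (suc (suc zero)) = refl
mainTheorem13 (suc (suc (suc m))) =
  trans (c-square-rec m)
        (cong (λ t → c (2 + m) * c (2 + m) + c m * c m + 2 * t)
              (trans (c-product≡weightedCSquares m) (sym (sumFromTo-3 m _))))
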